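{- Let $S\subseteq\mathbb{Z}^2$ be an antimatroidal point set. If $A=(x_A,y_A)\in S$ and $B=(x_B,y_B)\in S$, then $A\cap B=(\min(x_A,x_B),\min(y_A,y_B))\in S$.
   Context: A point $A=(x_A,y_A)\in\mathbb{Z}^2$ is regarded as a multiset over $\{x,y\}$; $A\subseteq B$ means $x_A\le x_B$ and $y_A\le y_B$. A finite nonempty set $S\subseteq\mathbb{Z}^2$ is an antimatroidal point set if (A1) for every $(x_A,y_A)\in S$ with $(x_A,y_A)\neq(0,0)$, either $(x_A-1,y_A)\in S$ or $(x_A,y_A-1)\in S$; (A2) for all $A,B\in S$ with $A\not\subseteq B$: if $x_A\ge x_B$ and $y_A\ge y_B$ then $(x_B+1,y_B)\in S$ or $(x_B,y_B+1)\in S$; if $x_A\le x_B$ and $y_A\ge y_B$ then $(x_B,y_B+1)\in S$; if $x_A\ge x_B$ and $y_A\le y_B$ then $(x_B+1,y_B)\in S$. -}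

module Defs where

open import Data.Integer using (ℤ; _+_; _≤_; _⊓_; 0ℤ; 1ℤ; _-_)
open import Data.Product using (_×_; _,_; proj₁; proj₂)
open import Data.Sum using (_⊎_)
open import Data.List using (List; [])
open import Data.List.Membership.Propositional using (_∈_)
open import Relation.Binary.PropositionalEquality using (_≡_; _≢_)
open import Relation.Nullary using (¬_)

Point : Set
Point = ℤ × ℤ

-- A ⊆ B as multisets over {x,y}
_⊆ₚ_ : Point → Point → Set
(xA , yA) ⊆ₚ (xB , yB) = (xA ≤ xB) × (yA ≤ yB)

_∩ₚ_ : Point → Point → Point
(xA , yA) ∩ₚ (xB , yB) = (xA ⊓ xB , yA ⊓ yB)

PointSet : Set
PointSet = List Point

A1 : PointSet → Set
A1 S = ∀ (x y : ℤ) → (x , y) ∈ S → (x , y) ≢ (0ℤ , 0ℤ) →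
       ((x - 1ℤ , y) ∈ S) ⊎ ((x , y - 1ℤ) ∈ S)

A2 : PointSet → Set
A2 S = ∀ (xA yA xB yB : ℤ) → (xA , yA) ∈ S → (xB , yB) ∈ S →
       ¬ ((xA , yA) ⊆ₚ (xB , yB)) →
       ((xB ≤ xA → yB ≤ yA → ((xB + 1ℤ , yB) ∈ S) ⊎ ((xB , yB + 1ℤ) ∈ S))
       × (xA ≤ xB → yB ≤ yA → (xB , yB + 1ℤ) ∈ S)
       × (xB ≤ xA → yA ≤ yB → (xB + 1ℤ , yB) ∈ S))

record IsAntimatroidalPointSet (S : PointSet) : Set where
  field
    nonempty : S ≢ []
    a1 : A1 S
    a2 : A2 S

-- Rows of an antimatroidal point set are intervals: by A2, a point of S lying strictly
-- left of another point of its row has its right neighbour in S.  Since S is finite,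
-- descending along A1 terminates, which shows that every point of S has y ≥ 0 and that
-- from A one reaches, weakly left of A, any row of S below A.  So if A lies weakly left
-- of and above B, the row of B contains a point left of x_A and the point B right of it,
-- hence A ∩ B = (x_A , y_B); in the other cases A ∩ B is A or B.
module Submission where

open import Defs
open import Data.List using (List; []; _∷_)
open import Data.List.Membership.Propositional using (_∈_)
open import Data.List.Relation.Unary.Any using (here; there)
open import Data.Integer using (ℤ; +_; _+_; _-_; _≤_; _<_; _⊓_; 0ℤ; 1ℤ; -_; ∣_∣)
open import Data.Integer.Properties
open import Data.Nat as ℕ using (ℕ; zero; suc)
open import Data.Nat.Induction using (<-wellFounded)
open import Data.Product using (∃-syntax; _×_; _,_; proj₁; proj₂)
open import Data.Sum using (inj₁; inj₂)
open import Data.Empty using (⊥-elim)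
open import Induction.WellFounded using (module All)
open import Relation.Binary.Construct.On as On using ()
open import Relation.Binary.PropositionalEquality
open import Relation.Nullary using (yes; no)
open import Relation.Binary.Definitions using (tri<; tri≈; tri>)

i-1<i : ∀ i → i - 1ℤ < i
i-1<i i = i≤pred[j]⇒i<j (≤-reflexive (+-comm i (- 1ℤ)))

i<i+1 : ∀ i → i < i + 1ℤ
i<i+1 i = suc[i]≤j⇒i<j (≤-reflexive (+-comm 1ℤ i))

i<j⇒i≤j-1 : ∀ {i j} → i < j → i ≤ j - 1ℤ
i<j⇒i≤j-1 {i} {j} i<j = subst (i ≤_) (+-comm (- 1ℤ) j) (i<j⇒i≤pred[j] i<j)

i+[j-i]≡j : ∀ i j → i + (j - i) ≡ j
i+[j-i]≡j i j = begin
  i + (j - i)    ≡⟨ +-comm i (j - i) ⟩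
  j - i + i      ≡⟨ +-assoc j (- i) i ⟩
  j + (- i + i)  ≡⟨ cong (_+_ j) (+-inverseˡ i) ⟩
  j + 0ℤ         ≡⟨ +-identityʳ j ⟩
  j              ∎
  where open ≡-Reasoning

∣-∣-mono-< : ∀ {i j} → 0ℤ ≤ i → i < j → ∣ i ∣ ℕ.< ∣ j ∣
∣-∣-mono-< 0≤i i<j = drop‿+<+ (subst₂ _<_
  (sym (0≤i⇒+∣i∣≡i 0≤i)) (sym (0≤i⇒+∣i∣≡i (≤-trans 0≤i (<⇒≤ i<j)))) i<j)

module _ {a} {A : Set a} (key : A → ℤ) where

  key-lowerBound : (xs : List A) → ∃[ ℓ ] (∀ {x} → x ∈ xs → ℓ ≤ key x)
  key-lowerBound [] = 0ℤ , λ ()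
  key-lowerBound (x ∷ xs) with key-lowerBound xs
  ... | ℓ , ℓ≤ = key x ⊓ ℓ , λ
    { (here refl) → i⊓j≤i (key x) ℓ
    ; (there y∈xs) → ≤-trans (i⊓j≤j (key x) ℓ) (ℓ≤ y∈xs) }

  ∈-key-descent : ∀ {p} (xs : List A) (P : A → Set p) →
    (∀ {x} → x ∈ xs → (∀ {y} → y ∈ xs → key y < key x → P y) → P x) →
    ∀ {x} → x ∈ xs → P x
  ∈-key-descent xs P step {x} =
    All.wfRec (On.wellFounded height <-wellFounded) _ (λ x → x ∈ xs → P x) rec x
    where
    ℓ : ℤ
    ℓ = proj₁ (key-lowerBound xs)

    height : A → ℕ
    height x = ∣ key x - ℓ ∣

    rec : ∀ x → (∀ {y} → height y ℕ.< height x → y ∈ xs → P y) → x ∈ xs → P x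
    rec x ih x∈xs = step x∈xs λ {y} y∈xs y<x → ih
      (∣-∣-mono-< (i≤j⇒0≤j-i (proj₂ (key-lowerBound xs) y∈xs)) (+-monoˡ-< (- ℓ) y<x))
      y∈xs

size : Point → ℤ
size (x , y) = x + y

module _ {S : PointSet} (a1 : A1 S) where

  size-left< : ∀ x y → size (x - 1ℤ , y) < size (x , y)
  size-left< x y = +-monoˡ-< y (i-1<i x)

  size-down< : ∀ x y → size (x , y - 1ℤ) < size (x , y)
  size-down< x y = +-monoʳ-< x (i-1<i y)

  A1⇒y-nonneg : ∀ {P} → P ∈ S → 0ℤ ≤ proj₂ P
  A1⇒y-nonneg = ∈-key-descent size S (λ P → 0ℤ ≤ proj₂ P) step
    where
    step : ∀ {P} → P ∈ S → (∀ {Q} → Q ∈ S → size Q < size P → 0ℤ ≤ proj₂ Q) → 0ℤ ≤ proj₂ P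
    step {x , y} P∈S ih with 0ℤ ≤? y
    ... | yes 0≤y = 0≤y
    ... | no 0≰y with a1 x y P∈S (λ P≡0 → 0≰y (≤-reflexive (sym (cong proj₂ P≡0))))
    ... | inj₁ left∈S = ih left∈S (size-left< x y)
    ... | inj₂ down∈S = ⊥-elim (0≰y (≤-trans (ih down∈S (size-down< x y)) (<⇒≤ (i-1<i y))))

  A1⇒descend-to-row : ∀ {y₀} → 0ℤ ≤ y₀ → ∀ {P} → P ∈ S → y₀ ≤ proj₂ P →
                      ∃[ x ] (x ≤ proj₁ P × (x , y₀) ∈ S)
  A1⇒descend-to-row {y₀} 0≤y₀ = ∈-key-descent size S Reaches step
    where
    Reaches : Point → Set
    Reaches P = y₀ ≤ proj₂ P → ∃[ x ] (x ≤ proj₁ P × (x , y₀) ∈ S)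

    step : ∀ {P} → P ∈ S → (∀ {Q} → Q ∈ S → size Q < size P → Reaches Q) → Reaches P
    step {x , y} P∈S ih y₀≤y with <-cmp y₀ y
    ... | tri≈ _ refl _ = x , ≤-refl , P∈S
    ... | tri> _ _ y<y₀ = ⊥-elim (<⇒≱ y<y₀ y₀≤y)
    ... | tri< y₀<y _ _ with a1 x y P∈S (λ P≡0 → <⇒≢ (≤-<-trans 0≤y₀ y₀<y) (sym (cong proj₂ P≡0)))
    ... | inj₂ down∈S = ih down∈S (size-down< x y) (i<j⇒i≤j-1 y₀<y)
    ... | inj₁ left∈S with ih left∈S (size-left< x y) y₀≤y
    ...   | x₀ , x₀≤x-1 , Q∈S = x₀ , ≤-trans x₀≤x-1 (<⇒≤ (i-1<i x)) , Q∈S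

module _ {S : PointSet} (a2 : A2 S) where

  A2⇒row-step : ∀ {x x' y} → (x , y) ∈ S → (x' , y) ∈ S → x < x' → (x + 1ℤ , y) ∈ S
  A2⇒row-step {x} {x'} {y} P∈S Q∈S x<x' =
    proj₂ (proj₂ (a2 x' y x y Q∈S P∈S (λ Q⊆P → <⇒≱ x<x' (proj₁ Q⊆P)))) (<⇒≤ x<x') ≤-refl

  A2⇒row-convex : ∀ {x x' X y} → (x , y) ∈ S → (x' , y) ∈ S → x ≤ X → X ≤ x' → (X , y) ∈ S
  A2⇒row-convex {x} {x'} {X} {y} P∈S Q∈S x≤X X≤x' =
    subst InRow x+∣X-x∣≡X (walk ∣ X - x ∣ P∈S (subst (_≤ x') (sym x+∣X-x∣≡X) X≤x'))
    where
    InRow : ℤ → Set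
    InRow z = (z , y) ∈ S

    x+∣X-x∣≡X : x + + ∣ X - x ∣ ≡ X
    x+∣X-x∣≡X = trans (cong (_+_ x) (0≤i⇒+∣i∣≡i (i≤j⇒0≤j-i x≤X))) (i+[j-i]≡j x X)

    walk : ∀ n {z} → InRow z → z + + n ≤ x' → InRow (z + + n)
    walk zero {z} z∈S _ = subst InRow (sym (+-identityʳ z)) z∈S
    walk (suc n) {z} z∈S z+[1+n]≤x' =
      subst InRow shift (walk n (A2⇒row-step z∈S Q∈S z<x') z+1+n≤x')
      where
      shift : z + 1ℤ + + n ≡ z + + suc n
      shift = +-assoc z 1ℤ (+ n)

      z+1+n≤x' : z + 1ℤ + + n ≤ x'
      z+1+n≤x' = subst (_≤ x') (sym shift) z+[1+n]≤x'

      z<x' : z < x'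
      z<x' = <-≤-trans (i<i+1 z) (≤-trans (i≤i+j (z + 1ℤ) (+ n)) z+1+n≤x')

module _ {S : PointSet} (a1 : A1 S) (a2 : A2 S) where

  corner∈ : ∀ {xA yA xB yB} → (xA , yA) ∈ S → (xB , yB) ∈ S →
            xA ≤ xB → yB ≤ yA → (xA , yB) ∈ S
  corner∈ A∈S B∈S xA≤xB yB≤yA with A1⇒descend-to-row a1 (A1⇒y-nonneg a1 B∈S) A∈S yB≤yA
  ... | x₀ , x₀≤xA , P∈S = A2⇒row-convex a2 P∈S B∈S x₀≤xA xA≤xB

  ∩ₚ-closed : ∀ {A B} → A ∈ S → B ∈ S → (A ∩ₚ B) ∈ S
  ∩ₚ-closed {xA , yA} {xB , yB} A∈S B∈S with ≤-total xA xB | ≤-total yA yB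
  ... | inj₁ xA≤xB | inj₁ yA≤yB rewrite i≤j⇒i⊓j≡i xA≤xB | i≤j⇒i⊓j≡i yA≤yB = A∈S
  ... | inj₁ xA≤xB | inj₂ yB≤yA rewrite i≤j⇒i⊓j≡i xA≤xB | i≥j⇒i⊓j≡j yB≤yA =
    corner∈ A∈S B∈S xA≤xB yB≤yA
  ... | inj₂ xB≤xA | inj₁ yA≤yB rewrite i≥j⇒i⊓j≡j xB≤xA | i≤j⇒i⊓j≡i yA≤yB =
    corner∈ B∈S A∈S xB≤xA yA≤yB
  ... | inj₂ xB≤xA | inj₂ yB≤yA rewrite i≥j⇒i⊓j≡j xB≤xA | i≥j⇒i⊓j≡j yB≤yA = B∈S

lemma1 : (S : PointSet) → IsAntimatroidalPointSet S →
    ∀ A B → A ∈ S → B ∈ S → (A ∩ₚ B) ∈ S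
lemma1 S ant A B = ∩ₚ-closed a1 a2
  where open IsAntimatroidalPointSet ant
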